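{- For multisets $A,B,C,D$ of integers, we have $C=A\uparrow B$ and $D=B\uparrow A$ if and only if $A=C\downarrow D$ and $B=D\downarrow C$.
   Context: For multisets $A,B$ of integers and an integer $n$: $A+n=\{x+n: x\in A\}$ (with multiplicity); $A\cap B$ is the multiset in which each integer occurs with multiplicity equal to the minimum of its multiplicities in $A$ and $B$; $A\uplus B$ is the multiset (disjoint) union; $A\setminus B$ is the multiset in which each integer $x$ occurs with multiplicity $\max(0,\,\mathrm{mult}_A(x)-\mathrm{mult}_B(x))$. Define $A\uparrow B=(A\setminus B)\uplus\big((A\cap B)+1\big)$ and $A\downarrow B=(A\setminus B)\uplus\big((A\cap B)-1\big)$. -}

module Defs where

open import Data.Nat using (ℕ; _+_; _∸_; _⊓_)
open import Data.Integer using (ℤ; +_; -[1+_]) renaming (_-_ to _-ℤ_)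
open import Relation.Binary.PropositionalEquality using (_≡_)

-- A multiset of integers, given by its multiplicity function
-- (mult A x = number of occurrences of x in A).
Multiset : Set
Multiset = ℤ → ℕ

infix 4 _≋_
_≋_ : Multiset → Multiset → Set
A ≋ B = ∀ x → A x ≡ B x

shift : Multiset → ℤ → Multiset
shift A n x = A (x -ℤ n)

_∩_ : Multiset → Multiset → Multiset
(A ∩ B) x = A x ⊓ B x

_⊎ₘ_ : Multiset → Multiset → Multiset
(A ⊎ₘ B) x = A x + B x

_∖_ : Multiset → Multiset → Multiset
(A ∖ B) x = A x ∸ B x

_↑_ : Multiset → Multiset → Multiset
A ↑ B = (A ∖ B) ⊎ₘ shift (A ∩ B) (+ 1)

_↓_ : Multiset → Multiset → Multiset
A ↓ B = (A ∖ B) ⊎ₘ shift (A ∩ B) -[1+ 0 ]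

-- At each point one of A ∖ B and B ∖ A vanishes, so C = A ↑ B and D = B ↑ A
-- have common part exactly (A ∩ B) + 1 and C ∖ D = A ∖ B; hence C ↓ D gives back
-- (A ∖ B) ⊎ (A ∩ B) = A. The same computation with the shift −1 in place of +1
-- gives the converse, so both directions are one lemma about shifting by k and −k.
module Submission where

open import Defs
open import Data.Product using (_×_; _,_)
open import Function.Bundles using (_⇔_; mk⇔)
open import Data.Nat using (zero; suc; _+_; _∸_; _⊓_)
open import Data.Nat.Properties
  using (+-comm; ⊓-comm; +-distribʳ-⊓; m⊓n+n∸m≡n; [m∸n]⊓[n∸m]≡0; [m+n]∸[m+o]≡n∸o)
open import Data.Integer using (ℤ; +_; -[1+_]; -_) renaming (_-_ to _-ℤ_; _+_ to _+ℤ_)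
open import Data.Integer.Properties using (+-assoc; +-inverseˡ; +-identityʳ)
open import Relation.Binary.PropositionalEquality using (_≡_; refl; sym; cong; cong₂; module ≡-Reasoning)

open ≡-Reasoning

m∸n+m⊓n≡m : ∀ m n → m ∸ n + m ⊓ n ≡ m
m∸n+m⊓n≡m m n = begin
  m ∸ n + m ⊓ n   ≡⟨ +-comm (m ∸ n) (m ⊓ n) ⟩
  m ⊓ n + (m ∸ n) ≡⟨ cong (_+ (m ∸ n)) (⊓-comm m n) ⟩
  n ⊓ m + (m ∸ n) ≡⟨ m⊓n+n∸m≡n n m ⟩
  m               ∎

[m∸n]∸[n∸m]≡m∸n : ∀ m n → (m ∸ n) ∸ (n ∸ m) ≡ m ∸ n
[m∸n]∸[n∸m]≡m∸n zero    zero    = refl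
[m∸n]∸[n∸m]≡m∸n zero    (suc n) = refl
[m∸n]∸[n∸m]≡m∸n (suc m) zero    = refl
[m∸n]∸[n∸m]≡m∸n (suc m) (suc n) = [m∸n]∸[n∸m]≡m∸n m n

[m∸n+o]∸[n∸m+o]≡m∸n : ∀ m n o → (m ∸ n + o) ∸ (n ∸ m + o) ≡ m ∸ n
[m∸n+o]∸[n∸m+o]≡m∸n m n o = begin
  (m ∸ n + o) ∸ (n ∸ m + o)     ≡⟨ cong₂ _∸_ (+-comm (m ∸ n) o) (+-comm (n ∸ m) o) ⟩
  (o + (m ∸ n)) ∸ (o + (n ∸ m)) ≡⟨ [m+n]∸[m+o]≡n∸o o (m ∸ n) (n ∸ m) ⟩
  (m ∸ n) ∸ (n ∸ m)             ≡⟨ [m∸n]∸[n∸m]≡m∸n m n ⟩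
  m ∸ n                         ∎

[m∸n+o]⊓[n∸m+o]≡o : ∀ m n o → (m ∸ n + o) ⊓ (n ∸ m + o) ≡ o
[m∸n+o]⊓[n∸m+o]≡o m n o = begin
  (m ∸ n + o) ⊓ (n ∸ m + o) ≡⟨ +-distribʳ-⊓ o (m ∸ n) (n ∸ m) ⟨
  (m ∸ n) ⊓ (n ∸ m) + o     ≡⟨ cong (_+ o) ([m∸n]⊓[n∸m]≡0 m n) ⟩
  o                         ∎

shift-inverse : ∀ (M : Multiset) k → shift (shift M k) (- k) ≋ M
shift-inverse M k x = cong M (begin
  x -ℤ - k -ℤ k     ≡⟨ +-assoc x (- - k) (- k) ⟩
  x +ℤ (- - k -ℤ k) ≡⟨ cong (x +ℤ_) (+-inverseˡ (- k)) ⟩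
  x +ℤ + 0          ≡⟨ +-identityʳ x ⟩
  x                 ∎)

bump : ℤ → Multiset → Multiset → Multiset
bump k A B = (A ∖ B) ⊎ₘ shift (A ∩ B) k

∖-⊎ₘ-∩ : ∀ (A B : Multiset) → A ≋ (A ∖ B) ⊎ₘ (A ∩ B)
∖-⊎ₘ-∩ A B x = sym (m∸n+m⊓n≡m (A x) (B x))

bump-swap-∩ : ∀ k (A B : Multiset) → bump k B A ≋ (B ∖ A) ⊎ₘ shift (A ∩ B) k
bump-swap-∩ k A B x = cong (_+_ ((B ∖ A) x)) (⊓-comm (B (x -ℤ k)) (A (x -ℤ k)))

module _ (k : ℤ) {A B C D : Multiset} (C≋ : C ≋ bump k A B) (D≋ : D ≋ bump k B A) where

  private
    D≋′ : D ≋ (B ∖ A) ⊎ₘ shift (A ∩ B) k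
    D≋′ x rewrite D≋ x = bump-swap-∩ k A B x

  ∖-of-bumps : C ∖ D ≋ A ∖ B
  ∖-of-bumps x rewrite C≋ x | D≋′ x =
    [m∸n+o]∸[n∸m+o]≡m∸n (A x) (B x) (A (x -ℤ k) ⊓ B (x -ℤ k))

  ∩-of-bumps : C ∩ D ≋ shift (A ∩ B) k
  ∩-of-bumps x rewrite C≋ x | D≋′ x =
    [m∸n+o]⊓[n∸m+o]≡o (A x) (B x) (A (x -ℤ k) ⊓ B (x -ℤ k))

  bump-inverse : A ≋ bump (- k) C D
  bump-inverse x = begin
    A x                                          ≡⟨ ∖-⊎ₘ-∩ A B x ⟩
    (A ∖ B) x + (A ∩ B) x                        ≡⟨ cong₂ _+_ (∖-of-bumps x) (shift-inverse (A ∩ B) k x) ⟨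
    (C ∖ D) x + shift (shift (A ∩ B) k) (- k) x  ≡⟨ cong (_+_ ((C ∖ D) x)) (∩-of-bumps (x -ℤ - k)) ⟨
    bump (- k) C D x                             ∎

lemma3p2 : (A B C D : Multiset) →
    ((C ≋ A ↑ B) × (D ≋ B ↑ A)) ⇔ ((A ≋ C ↓ D) × (B ≋ D ↓ C))
lemma3p2 A B C D = mk⇔
  (λ (C≋ , D≋) → bump-inverse (+ 1) C≋ D≋ , bump-inverse (+ 1) D≋ C≋)
  (λ (A≋ , B≋) → bump-inverse -[1+ 0 ] A≋ B≋ , bump-inverse -[1+ 0 ] B≋ A≋)
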